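{- There is an infinite family of trees whose number of minimal zero forcing sets is polynomial in the number of vertices $n$, and there is an infinite family of trees whose number of minimal zero forcing sets is exponential in $n$.
   Context: All graphs are finite, simple and undirected. Given a set $S$ of initially blue vertices (all others white), the zero forcing color change rule says that a blue vertex with exactly one white neighbor causes that neighbor to become blue. $S$ is a zero forcing set if repeatedly applying this rule eventually makes every vertex blue. A minimal zero forcing set is a zero forcing set containing no other zero forcing set as a proper subset. -}

module Defs where

open import Data.Nat using (ℕ; suc; _≤_; _<_; _*_; _^_)
open import Data.Fin using (Fin)
open import Data.Fin.Subset using (Subset; _∈_; _⊂_)
open import Data.List using (List; []; _∷_; _++_; length)
open import Data.List.Relation.Unary.Linked using (Linked)
open import Data.List.Relation.Unary.Unique.Propositional using (Unique)
open import Data.List.Relation.Unary.All using (All)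
open import Data.List.Membership.Propositional renaming (_∈_ to _∈ₗ_)
open import Data.Product using (Σ; ∃; _×_)
open import Relation.Binary.PropositionalEquality using (_≡_; _≢_)
open import Relation.Nullary using (¬_)

record Graph (n : ℕ) : Set₁ where
  field
    Adj   : Fin n → Fin n → Set
    sym   : ∀ {u v} → Adj u v → Adj v u
    irrefl : ∀ {u} → ¬ Adj u u
open Graph public

module _ {n : ℕ} (G : Graph n) where

  data Walk : Fin n → Fin n → Set where
    here : ∀ {u} → Walk u u
    step : ∀ {u v w} → Adj G u v → Walk v w → Walk u w

  Connected : Set
  Connected = ∀ u v → Walk u v

  -- a cycle: distinct vertices x, z₁, …, z_k, y (k ≥ 1, so length ≥ 3),
  -- consecutive ones adjacent, and y adjacent to x
  HasCycle : Set
  HasCycle = Σ (Fin n) λ x → Σ (Fin n) λ y → Σ (List (Fin n)) λ zs →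
    (1 ≤ length zs) × Linked (Adj G) (x ∷ zs ++ y ∷ []) ×
    Unique (x ∷ zs ++ y ∷ []) × Adj G y x

  IsTree : Set
  IsTree = Connected × ¬ HasCycle

  -- Vertices eventually turned blue from initial blue set S under the
  -- zero forcing colour change rule (closure of the rule).
  data Blue (S : Subset n) : Fin n → Set where
    init  : ∀ {v} → v ∈ S → Blue S v
    force : ∀ {u v} → Blue S u → Adj G u v →
            (∀ w → Adj G u w → w ≢ v → Blue S w) → Blue S v

  ZeroForcing : Subset n → Set
  ZeroForcing S = ∀ v → Blue S v

  MinimalZF : Subset n → Set
  MinimalZF S = ZeroForcing S × (∀ S′ → S′ ⊂ S → ¬ ZeroForcing S′)

  AtMostMinZF : ℕ → Set
  AtMostMinZF B = Σ (List (Subset n)) λ L →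
    (length L ≤ B) × (∀ S → MinimalZF S → S ∈ₗ L)

  AtLeastMinZF : ℕ → Set
  AtLeastMinZF B = Σ (List (Subset n)) λ L →
    Unique L × All MinimalZF L × (B ≤ length L)

PolyFamily : Set₁
PolyFamily = Σ ℕ λ c → Σ ℕ λ k → ∀ m → Σ ℕ λ n → (m ≤ n) ×
  Σ (Graph n) λ G → IsTree G × AtMostMinZF G (c * n ^ k)

-- An infinite family of trees whose number of minimal zero forcing sets
-- is exponential: count ≥ (p/q)^n / d with p > q ≥ 1, d ≥ 1,
-- i.e. p ^ n ≤ d * q ^ n * count.
ExpFamily : Set₁
ExpFamily = Σ ℕ λ p → Σ ℕ λ q → Σ ℕ λ d → (1 ≤ q) × (q < p) × (1 ≤ d) ×
  (∀ m → Σ ℕ λ n → (m ≤ n) × Σ (Graph n) λ G → IsTree G ×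
    Σ ℕ λ cnt → (p ^ n ≤ d * q ^ n * cnt) × AtLeastMinZF G cnt)

-- Two leaves of a star have the same neighbourhood, hence form a fort, so a zero forcing
-- set of the star K₁,ₖ misses at most one leaf: its minimal zero forcing sets are among
-- the k sets "all leaves but one".  In the spider with r + 2 legs of length two, avoiding
-- leg 0, taking the leaf of leg 1 and one of the two vertices of every other leg gives 2ʳ
-- zero forcing sets on 2r + 5 vertices; each is minimal because legs 0 and i form a fort
-- meeting it only in its vertex on leg i.
-- Both graphs are trees since they carry a depth function in which every vertex has at
-- most one neighbour above it: a cycle gives a closed non-backtracking walk, and such a
-- walk, once it steps down, keeps stepping down.

module Submission where

open import Defs
open import Data.Nat using (ℕ; zero; suc; _+_; _*_; _^_; _≤_; _<_; z≤n; s≤s)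
open import Data.Nat.Properties
  using (<-trans; <-irrefl; <-asym; ≤-refl; ≤-reflexive; ≤-trans; n≤1+n; m≤m+n; m≤n+m; ≤ᵇ⇒≤;
         +-identityʳ; +-suc; *-identityˡ; *-assoc; *-monoˡ-≤; *-monoʳ-≤; ^-identityʳ; module ≤-Reasoning)
open import Data.Nat.Tactic.RingSolver using (solve-∀)
open import Data.Fin using (Fin; zero; suc; _↑ˡ_; _↑ʳ_; splitAt; _≟_)
open import Data.Fin.Properties
  using (suc-injective; any?; ↑ˡ-injective; ↑ʳ-injective; splitAt-↑ˡ; splitAt-↑ʳ; splitAt⁻¹-↑ˡ; splitAt⁻¹-↑ʳ)
open import Data.Fin.Subset using (Subset; _∈_; _∉_; _⊆_; _⊂_; inside; outside; ⁅_⁆; ∁)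
open import Data.Fin.Subset.Properties
  using (_∈?_; ⊆-antisym; x∉p⇒x∈∁p; x∈∁p⇒x∉p; x≢y⇒x∉⁅y⁆; x∉⁅y⁆⇒x≢y)
open import Data.Vec.Properties using (∷-injectiveʳ; ++-injectiveˡ)
open import Data.Vec using (here; there) renaming ([] to []ᵛ; _∷_ to _∷ᵛ_; _++_ to _++ᵛ_)
open import Data.List using (List; []; _∷_; _++_; length; map; tabulate)
open import Data.List.Properties using (length-++; length-map; length-tabulate)
open import Data.List.Relation.Unary.Linked as Linked using (Linked; [-]; _∷_)
open import Data.List.Relation.Unary.Linked.Properties using (Linked⇒AllPairs)
open import Data.List.Relation.Unary.AllPairs using (AllPairs; []; _∷_)
open import Data.List.Relation.Unary.All as All using (All; []; _∷_)
open import Data.List.Relation.Unary.All.Properties as All using (++⁻ˡ; tabulate⁺)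
open import Data.List.Relation.Unary.Any using (here; there)
open import Data.List.Membership.Propositional using () renaming (_∈_ to _∈ₗ_)
open import Data.List.Membership.Propositional.Properties using (∈-++⁺ʳ; ∈-map⁻; ∈-tabulate⁺)
open import Data.List.Relation.Unary.Unique.Propositional using (Unique)
open import Data.List.Relation.Unary.Unique.Propositional.Properties as Unique using (++⁺)
open import Data.Product using (Σ; _×_; _,_; proj₁; proj₂)
open import Function using (_∘_; flip)
open import Data.Sum using (_⊎_; inj₁; inj₂; [_,_]′)
open import Data.Unit using (⊤)
open import Data.Empty using (⊥; ⊥-elim)
open import Relation.Nullary using (¬_; ¬?; yes; no)
open import Relation.Binary.Definitions using (Transitive)
open import Relation.Binary.PropositionalEquality
  using (_≡_; _≢_; refl; ≢-sym; subst; cong; cong₂; module ≡-Reasoning)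
  renaming (sym to ≡-sym; trans to ≡-trans)

module _ {A : Set} where

  NoBacktrack : List A → Set
  NoBacktrack (u ∷ v ∷ w ∷ rest) = u ≢ w × NoBacktrack (v ∷ w ∷ rest)
  NoBacktrack _                  = ⊤

  LastStep : (A → A → Set) → List A → Set
  LastStep R (u ∷ v ∷ [])       = R u v
  LastStep R (_ ∷ v ∷ w ∷ rest) = LastStep R (v ∷ w ∷ rest)
  LastStep R _                  = ⊥

  lastStep-++ : ∀ {R u v} xs → LastStep R (xs ++ u ∷ v ∷ []) → R u v
  lastStep-++         []               r = r
  lastStep-++         (_ ∷ [])         r = r
  lastStep-++ {R} (_ ∷ b ∷ [])     r = lastStep-++ {R} (b ∷ []) r
  lastStep-++ {R} (_ ∷ b ∷ c ∷ xs) r = lastStep-++ {R} (b ∷ c ∷ xs) r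

  linked-∷ʳ : ∀ {R : A → A → Set} {u v} xs →
              Linked R (xs ++ u ∷ []) → R u v → Linked R (xs ++ u ∷ v ∷ [])
  linked-∷ʳ []           _             r = r ∷ [-]
  linked-∷ʳ (_ ∷ [])     (r₁ ∷ [-])    r = r₁ ∷ r ∷ [-]
  linked-∷ʳ (_ ∷ b ∷ xs) (r₁ ∷ links) r = r₁ ∷ linked-∷ʳ (b ∷ xs) links r

  noBacktrack-close : ∀ {x} u v zs y → AllPairs _≢_ (u ∷ v ∷ zs ++ y ∷ []) →
                      All (_≢ x) (v ∷ zs) → NoBacktrack (u ∷ v ∷ zs ++ y ∷ x ∷ [])
  noBacktrack-close u v []       y ((_ ∷ u≢y ∷ []) ∷ _) (v≢x ∷ _) = u≢y , v≢x , _
  noBacktrack-close u v (w ∷ zs) y ((_ ∷ u≢w ∷ _) ∷ distinct) (_ ∷ ≢x) =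
    u≢w , noBacktrack-close v w zs y distinct ≢x

  linked-order-not-closed : ∀ {R : A → A → Set} {u v} → Transitive R → (∀ {x} → ¬ R x x) →
                            ∀ mid → ¬ Linked R (u ∷ v ∷ mid ++ u ∷ v ∷ [])
  linked-order-not-closed trans irrefl mid links with Linked⇒AllPairs trans links
  ... | Ru ∷ _ = irrefl (All.lookup Ru (there (∈-++⁺ʳ mid (here refl))))

module _ {n : ℕ} {G : Graph n} where

  _++ʷ_ : ∀ {u v w} → Walk G u v → Walk G v w → Walk G u w
  here       ++ʷ q = q
  step a p   ++ʷ q = step a (p ++ʷ q)

  reverseʷ : ∀ {u v} → Walk G u v → Walk G v u
  reverseʷ here       = here
  reverseʷ (step a p) = reverseʷ p ++ʷ step (sym G a) here

  connected-via : ∀ r → (∀ v → Walk G v r) → Connected G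
  connected-via r toRoot u v = toRoot u ++ʷ reverseʷ (toRoot v)

module _ {n : ℕ} (G : Graph n) (depth : Fin n → ℕ) where

  StepDown StepUp : Fin n → Fin n → Set
  StepDown u v = depth v ≡ suc (depth u)
  StepUp   u v = StepDown v u

  record IsTreeDepth : Set where
    field
      adjacent-levels : ∀ {u v} → Adj G u v → StepDown u v ⊎ StepUp u v
      unique-parent   : ∀ {u v w} → Adj G u v → Adj G u w →
                        StepUp u v → StepUp u w → v ≡ w

  module _ (isTreeDepth : IsTreeDepth) where
    open IsTreeDepth isTreeDepth

    stepDown⇒< : ∀ {u v} → StepDown u v → depth u < depth v
    stepDown⇒< d = ≤-reflexive (≡-sym d)

    stepDown-continues : ∀ {u v w} → Adj G u v → Adj G v w → u ≢ w →
                         StepDown u v → StepDown v w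
    stepDown-continues uv vw u≢w down with adjacent-levels vw
    ... | inj₁ down′ = down′
    ... | inj₂ up    = ⊥-elim (u≢w (unique-parent (sym G uv) vw down up))

    descending : ∀ {u v} rest → Linked (Adj G) (u ∷ v ∷ rest) →
                 NoBacktrack (u ∷ v ∷ rest) → StepDown u v →
                 Linked StepDown (u ∷ v ∷ rest)
    descending []         _             _          down = down ∷ [-]
    descending (w ∷ rest) (uv ∷ links) (u≢w , nb) down =
      down ∷ descending rest links nb (stepDown-continues uv (Linked.head links) u≢w down)

    -- A non-backtracking walk climbs towards the root and then only descends.
    ascending-or-descends-last : ∀ {u v} rest → Linked (Adj G) (u ∷ v ∷ rest) →
                                 NoBacktrack (u ∷ v ∷ rest) →
                                 Linked StepUp (u ∷ v ∷ rest) ⊎ LastStep StepDown (u ∷ v ∷ rest)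
    ascending-or-descends-last [] (uv ∷ [-]) _ with adjacent-levels uv
    ... | inj₁ down = inj₂ down
    ... | inj₂ up   = inj₁ (up ∷ [-])
    ascending-or-descends-last (w ∷ rest) (uv ∷ links) (u≢w , nb)
      with ascending-or-descends-last rest links nb
    ... | inj₂ last = inj₂ last
    ... | inj₁ ups with adjacent-levels uv
    ...   | inj₂ up   = inj₁ (up ∷ ups)
    ...   | inj₁ down = ⊥-elim (<-asym (stepDown⇒< vw-down) (stepDown⇒< (Linked.head ups)))
      where vw-down = stepDown-continues uv (Linked.head links) u≢w down

    no-closed-walk : ∀ {u v} mid → Linked (Adj G) (u ∷ v ∷ mid ++ u ∷ v ∷ []) →
                     ¬ NoBacktrack (u ∷ v ∷ mid ++ u ∷ v ∷ [])
    no-closed-walk {u} {v} mid walk nb with ascending-or-descends-last (mid ++ u ∷ v ∷ []) walk nb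
    ... | inj₁ ups  = linked-order-not-closed (flip <-trans) (<-irrefl refl) mid
                        (Linked.map stepDown⇒< ups)
    ... | inj₂ last = linked-order-not-closed <-trans (<-irrefl refl) mid
                        (Linked.map stepDown⇒< (descending _ walk nb (lastStep-++ (u ∷ v ∷ mid) last)))

    treeDepth-acyclic : ¬ HasCycle G
    treeDepth-acyclic (_ , _ , [] , () , _)
    treeDepth-acyclic (x , y , z ∷ zs , _ , path , distinct@(x-fresh ∷ z-fresh ∷ _) , yx) =
      no-closed-walk (z ∷ zs) (yx ∷ linked-∷ʳ (x ∷ z ∷ zs) path yx)
        (y≢z , noBacktrack-close x z zs y distinct (All.map ≢-sym (++⁻ˡ (z ∷ zs) x-fresh)))
      where
      y≢z : y ≢ z
      y≢z = ≢-sym (All.lookup z-fresh (∈-++⁺ʳ zs (here refl)))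

module _ {n : ℕ} (G : Graph n) where

  IsFort : (Fin n → Set) → Set
  IsFort F = ∀ {u v} → ¬ F u → F v → Adj G u v → Σ (Fin n) λ w → F w × Adj G u w × w ≢ v

  -- A vertex outside a fort never has a fort vertex as its only white neighbour.
  fort-stays-white : ∀ {F S} → IsFort F → (∀ {v} → v ∈ S → ¬ F v) →
                     ∀ {v} → Blue G S v → ¬ F v
  fort-stays-white fort disjoint (init v∈S) = disjoint v∈S
  fort-stays-white fort disjoint (force blue-u uv others) Fv
    with fort (fort-stays-white fort disjoint blue-u) Fv uv
  ... | w , Fw , uw , w≢v = fort-stays-white fort disjoint (others w uw w≢v) Fw

  fort-avoided⇒¬ZeroForcing : ∀ {F S v} → IsFort F → F v →
                              (∀ {w} → w ∈ S → ¬ F w) → ¬ ZeroForcing G S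
  fort-avoided⇒¬ZeroForcing fort Fv disjoint zf = fort-stays-white fort disjoint (zf _) Fv

  twins-fort : ∀ {i j} → i ≢ j → (∀ {u} → Adj G u i → Adj G u j) → (∀ {u} → Adj G u j → Adj G u i) →
               IsFort (λ v → v ≡ i ⊎ v ≡ j)
  twins-fort i≢j i→j j→i _ (inj₁ refl) ui = _ , inj₂ refl , i→j ui , ≢-sym i≢j
  twins-fort i≢j i→j j→i _ (inj₂ refl) uj = _ , inj₁ refl , j→i uj , i≢j

  force-pendant : ∀ {S u v} → Blue G S u → Adj G u v → (∀ {w} → Adj G u w → w ≡ v) → Blue G S v
  force-pendant blue-u uv pendant = force blue-u uv (λ w uw w≢v → ⊥-elim (w≢v (pendant uw)))

  minimalZF-⊆⇒≡ : ∀ {S T} → MinimalZF G S → ZeroForcing G T → T ⊆ S → S ≡ T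
  minimalZF-⊆⇒≡ {S} {T} (_ , minimal) zf-T T⊆S = ⊆-antisym S⊆T T⊆S
    where
    S⊆T : S ⊆ T
    S⊆T {x} x∈S with x ∈? T
    ... | yes x∈T = x∈T
    ... | no  x∉T = ⊥-elim (minimal T (T⊆S , x , x∈S , x∉T) zf-T)

  minimalZF∈candidates : (L : List (Subset n)) → All (ZeroForcing G) L →
                         (∀ S → ZeroForcing G S → Σ (Subset n) λ T → T ∈ₗ L × T ⊆ S) →
                         ∀ S → MinimalZF G S → S ∈ₗ L
  minimalZF∈candidates L zf-L below S minimal with below S (proj₁ minimal)
  ... | T , T∈L , T⊆S = subst (_∈ₗ L) (≡-sym (minimalZF-⊆⇒≡ minimal (All.lookup zf-L T∈L) T⊆S)) T∈L

  PrivateFort : Subset n → Fin n → Set₁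
  PrivateFort S x = Σ (Fin n → Set) λ F → IsFort F × F x × (∀ {w} → w ∈ S → F w → w ≡ x)

  privateForts⇒minimalZF : ∀ {S} → ZeroForcing G S → (∀ {x} → x ∈ S → PrivateFort S x) →
                           MinimalZF G S
  privateForts⇒minimalZF zf privateFort = zf , not-zf
    where
    not-zf : ∀ S′ → S′ ⊂ _ → ¬ ZeroForcing G S′
    not-zf S′ (S′⊆S , x , x∈S , x∉S′) with privateFort x∈S
    ... | F , fort , Fx , private-x =
      fort-avoided⇒¬ZeroForcing fort Fx
        (λ w∈S′ Fw → x∉S′ (subst (_∈ S′) (private-x (S′⊆S w∈S′) Fw) w∈S′))

module _ {n : ℕ} where

  ∈-++-↑ˡ⁺ : ∀ {m i} {p : Subset m} {q : Subset n} → i ∈ p → i ↑ˡ n ∈ p ++ᵛ q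
  ∈-++-↑ˡ⁺ here      = here
  ∈-++-↑ˡ⁺ (there i) = there (∈-++-↑ˡ⁺ i)

  ∈-++-↑ˡ⁻ : ∀ {m i} {p : Subset m} {q : Subset n} → i ↑ˡ n ∈ p ++ᵛ q → i ∈ p
  ∈-++-↑ˡ⁻ {i = zero}  {_ ∷ᵛ _} here      = here
  ∈-++-↑ˡ⁻ {i = suc _} {_ ∷ᵛ _} (there i) = there (∈-++-↑ˡ⁻ i)

  ∈-++-↑ʳ⁺ : ∀ {m j} (p : Subset m) {q : Subset n} → j ∈ q → m ↑ʳ j ∈ p ++ᵛ q
  ∈-++-↑ʳ⁺ []ᵛ       j = j
  ∈-++-↑ʳ⁺ (_ ∷ᵛ p) j = there (∈-++-↑ʳ⁺ p j)

  ∈-++-↑ʳ⁻ : ∀ {m j} (p : Subset m) {q : Subset n} → m ↑ʳ j ∈ p ++ᵛ q → j ∈ q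
  ∈-++-↑ʳ⁻ []ᵛ       j         = j
  ∈-++-↑ʳ⁻ (_ ∷ᵛ p) (there j) = ∈-++-↑ʳ⁻ p j

allSubsets : ∀ r → List (Subset r)
allSubsets zero    = []ᵛ ∷ []
allSubsets (suc r) = map (inside ∷ᵛ_) (allSubsets r) ++ map (outside ∷ᵛ_) (allSubsets r)

length-allSubsets : ∀ r → length (allSubsets r) ≡ 2 ^ r
length-allSubsets zero    = refl
length-allSubsets (suc r) = begin
  length (map (inside ∷ᵛ_) subsets ++ map (outside ∷ᵛ_) subsets)
    ≡⟨ length-++ (map (inside ∷ᵛ_) subsets) ⟩
  length (map (inside ∷ᵛ_) subsets) + length (map (outside ∷ᵛ_) subsets)
    ≡⟨ cong₂ _+_ (length-map (inside ∷ᵛ_) subsets) (length-map (outside ∷ᵛ_) subsets) ⟩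
  length subsets + length subsets
    ≡⟨ cong (λ l → l + l) (length-allSubsets r) ⟩
  2 ^ r + 2 ^ r
    ≡⟨ cong (2 ^ r +_) (≡-sym (+-identityʳ (2 ^ r))) ⟩
  2 ^ suc r ∎
  where
  open ≡-Reasoning
  subsets : List (Subset r)
  subsets = allSubsets r

allSubsets-unique : ∀ r → Unique (allSubsets r)
allSubsets-unique zero    = [] ∷ []
allSubsets-unique (suc r) = ++⁺ (Unique.map⁺ ∷-injectiveʳ (allSubsets-unique r))
                                (Unique.map⁺ ∷-injectiveʳ (allSubsets-unique r))
                                heads-differ
  where
  heads-differ : ∀ {p} → ¬ (p ∈ₗ map (inside ∷ᵛ_) (allSubsets r) × p ∈ₗ map (outside ∷ᵛ_) (allSubsets r))
  heads-differ (p∈ins , p∈outs) with ∈-map⁻ (inside ∷ᵛ_) p∈ins | ∈-map⁻ (outside ∷ᵛ_) p∈outs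
  ... | _ , _ , refl | _ , _ , ()

module Star (k : ℕ) where

  Adjˢ : Fin (suc k) → Fin (suc k) → Set
  Adjˢ zero    (suc _) = ⊤
  Adjˢ (suc _) zero    = ⊤
  Adjˢ _       _       = ⊥

  star : Graph (suc k)
  star = record { Adj = Adjˢ ; sym = λ {u} {v} → symˢ u v ; irrefl = λ {u} → irreflˢ u }
    where
    symˢ : ∀ u v → Adjˢ u v → Adjˢ v u
    symˢ zero    (suc _) _ = _
    symˢ (suc _) zero    _ = _

    irreflˢ : ∀ u → ¬ Adjˢ u u
    irreflˢ zero    ()
    irreflˢ (suc _) ()

  leaf-pendant : ∀ {i w} → Adjˢ (suc i) w → w ≡ zero
  leaf-pendant {w = zero} _ = refl

  leaves-twins : ∀ {u i j} → Adjˢ u (suc i) → Adjˢ u (suc j)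
  leaves-twins {zero} _ = _

  depthˢ : Fin (suc k) → ℕ
  depthˢ zero    = 0
  depthˢ (suc _) = 1

  star-treeDepth : IsTreeDepth star depthˢ
  star-treeDepth = record { adjacent-levels = levels ; unique-parent = parent }
    where
    levels : ∀ {u v} → Adjˢ u v → StepDown star depthˢ u v ⊎ StepUp star depthˢ u v
    levels {zero}  {suc _} _ = inj₁ refl
    levels {suc _} {zero}  _ = inj₂ refl

    parent : ∀ {u v w} → Adjˢ u v → Adjˢ u w →
             StepUp star depthˢ u v → StepUp star depthˢ u w → v ≡ w
    parent {suc _} uv uw _ _ = ≡-trans (leaf-pendant uv) (≡-sym (leaf-pendant uw))

  star-isTree : IsTree star
  star-isTree = connected-via zero to-centre , treeDepth-acyclic star depthˢ star-treeDepth
    where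
    to-centre : ∀ v → Walk star v zero
    to-centre zero    = here
    to-centre (suc _) = step _ here

-- k ≥ 2 leaves, so that for every l some other leaf forces the centre.
module StarZF (m : ℕ) where

  k : ℕ
  k = suc (suc m)

  open Star k

  allLeavesBut : Fin k → Subset (suc k)
  allLeavesBut l = outside ∷ᵛ ∁ ⁅ l ⁆

  leaf∈allLeavesBut : ∀ {i l} → i ≢ l → suc i ∈ allLeavesBut l
  leaf∈allLeavesBut i≢l = there (x∉p⇒x∈∁p (x≢y⇒x∉⁅y⁆ i≢l))

  ∈allLeavesBut⇒leaf : ∀ {x l} → x ∈ allLeavesBut l → Σ (Fin k) λ i → x ≡ suc i × i ≢ l
  ∈allLeavesBut⇒leaf (there i∈) = _ , refl , x∉⁅y⁆⇒x≢y (x∈∁p⇒x∉p i∈)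

  another : Fin k → Fin k
  another zero    = suc zero
  another (suc _) = zero

  another≢ : ∀ l → another l ≢ l
  another≢ zero    ()
  another≢ (suc _) ()

  centre-blue : ∀ l → Blue star (allLeavesBut l) zero
  centre-blue l = force-pendant star (init (leaf∈allLeavesBut (another≢ l))) _ leaf-pendant

  allLeavesBut-zeroForcing : ∀ l → ZeroForcing star (allLeavesBut l)
  allLeavesBut-zeroForcing l zero = centre-blue l
  allLeavesBut-zeroForcing l (suc i) with i ≟ l
  ... | no i≢l  = init (leaf∈allLeavesBut i≢l)
  ... | yes refl = force (centre-blue l) _ other-leaves
    where
    other-leaves : ∀ w → Adjˢ zero w → w ≢ suc l → Blue star (allLeavesBut l) w
    other-leaves (suc j) _ j≢l = init (leaf∈allLeavesBut (λ j≡l → j≢l (cong suc j≡l)))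

  two-leaves-missing⇒¬ZeroForcing : ∀ {S i l} → i ≢ l → suc i ∉ S → suc l ∉ S → ¬ ZeroForcing star S
  two-leaves-missing⇒¬ZeroForcing i≢l i∉S l∉S =
    fort-avoided⇒¬ZeroForcing star (twins-fort star (λ i≡l → i≢l (suc-injective i≡l)) leaves-twins leaves-twins)
      (inj₁ refl) λ { i∈S (inj₁ refl) → i∉S i∈S ; l∈S (inj₂ refl) → l∉S l∈S }

  allLeavesBut-⊆ : ∀ {S} l → (∀ {i} → i ≢ l → suc i ∉ S → ⊥) → allLeavesBut l ⊆ S
  allLeavesBut-⊆ {S} l no-other-missing x∈ with ∈allLeavesBut⇒leaf x∈
  ... | i , refl , i≢l with suc i ∈? S
  ...   | yes i∈S = i∈S
  ...   | no  i∉S = ⊥-elim (no-other-missing i≢l i∉S)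

  zeroForcing⊇allLeavesBut : ∀ S → ZeroForcing star S → Σ (Subset (suc k)) λ T →
                             T ∈ₗ tabulate allLeavesBut × T ⊆ S
  zeroForcing⊇allLeavesBut S zf with any? (λ i → ¬? (suc i ∈? S))
  ... | yes (l , l∉S) = allLeavesBut l , ∈-tabulate⁺ {f = allLeavesBut} l ,
                        allLeavesBut-⊆ l (λ i≢l i∉S → two-leaves-missing⇒¬ZeroForcing i≢l i∉S l∉S zf)
  ... | no none-missing = allLeavesBut zero , ∈-tabulate⁺ {f = allLeavesBut} zero ,
                          allLeavesBut-⊆ zero (λ _ i∉S → none-missing (_ , i∉S))

  star-atMost : AtMostMinZF star (1 * suc k ^ 1)
  star-atMost = tabulate allLeavesBut , length-bound ,
    minimalZF∈candidates star (tabulate allLeavesBut) (tabulate⁺ allLeavesBut-zeroForcing) zeroForcing⊇allLeavesBut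
    where
    length-bound : length (tabulate allLeavesBut) ≤ 1 * suc k ^ 1
    length-bound = begin
      length (tabulate allLeavesBut) ≡⟨ length-tabulate allLeavesBut ⟩
      k                              ≤⟨ n≤1+n k ⟩
      suc k                          ≡⟨ ≡-sym (^-identityʳ (suc k)) ⟩
      suc k ^ 1                      ≡⟨ ≡-sym (*-identityˡ (suc k ^ 1)) ⟩
      1 * suc k ^ 1                  ∎
      where open ≤-Reasoning

-- The spider with k legs of length two: centre zero, leg i is the path zero — A i — B i.
module Spider (k : ℕ) where

  V : Set
  V = Fin (suc (k + k))

  A B : Fin k → V
  A i = suc (i ↑ˡ k)
  B i = suc (k ↑ʳ i)

  A-injective : ∀ {i j} → A i ≡ A j → i ≡ j
  A-injective A≡ = ↑ˡ-injective k _ _ (suc-injective A≡)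

  B-injective : ∀ {i j} → B i ≡ B j → i ≡ j
  B-injective B≡ = ↑ʳ-injective k _ _ (suc-injective B≡)

  data View : V → Set where
    centre : View zero
    outer  : ∀ i → View (A i)
    leaf   : ∀ i → View (B i)

  view : ∀ v → View v
  view zero    = centre
  view (suc j) with splitAt k j in eq
  ... | inj₁ i = subst View (cong suc (splitAt⁻¹-↑ˡ eq)) (outer i)
  ... | inj₂ i = subst View (cong suc (splitAt⁻¹-↑ʳ eq)) (leaf i)

  data Adjˢ : V → V → Set where
    centre-A : ∀ i → Adjˢ zero (A i)
    A-centre : ∀ i → Adjˢ (A i) zero
    A-B      : ∀ i → Adjˢ (A i) (B i)
    B-A      : ∀ i → Adjˢ (B i) (A i)

  symˢ : ∀ {u v} → Adjˢ u v → Adjˢ v u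
  symˢ (centre-A i) = A-centre i
  symˢ (A-centre i) = centre-A i
  symˢ (A-B i)      = B-A i
  symˢ (B-A i)      = A-B i

  depthˢ : V → ℕ
  depthˢ zero    = 0
  depthˢ (suc j) = [ (λ _ → 1) , (λ _ → 2) ]′ (splitAt k j)

  depth-A : ∀ i → depthˢ (A i) ≡ 1
  depth-A i = cong [ (λ _ → 1) , (λ _ → 2) ]′ (splitAt-↑ˡ k i k)

  depth-B : ∀ i → depthˢ (B i) ≡ 2
  depth-B i = cong [ (λ _ → 1) , (λ _ → 2) ]′ (splitAt-↑ʳ k k i)

  A≢B : ∀ {i j} → A i ≢ B j
  A≢B {i} {j} A≡B with ≡-trans (≡-sym (depth-A i)) (≡-trans (cong depthˢ A≡B) (depth-B j))
  ... | ()

  spider : Graph (suc (k + k))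
  spider = record { Adj = Adjˢ ; sym = symˢ ; irrefl = λ uu → irreflˢ uu refl }
    where
    irreflˢ : ∀ {u v} → Adjˢ u v → u ≢ v
    irreflˢ (centre-A i) ()
    irreflˢ (A-centre i) ()
    irreflˢ (A-B i)      = A≢B
    irreflˢ (B-A i)      = A≢B ∘ ≡-sym

  nbr-centre : ∀ {w} → Adjˢ zero w → Σ (Fin k) λ j → w ≡ A j
  nbr-centre (centre-A j) = j , refl

  nbr-A : ∀ {u w i} → Adjˢ u w → u ≡ A i → w ≡ zero ⊎ w ≡ B i
  nbr-A (centre-A _) ()
  nbr-A (A-centre _) _   = inj₁ refl
  nbr-A (A-B _)      u≡A = inj₂ (cong B (A-injective u≡A))
  nbr-A (B-A _)      u≡A = ⊥-elim (A≢B (≡-sym u≡A))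

  nbr-B : ∀ {u w i} → Adjˢ u w → u ≡ B i → w ≡ A i
  nbr-B (centre-A _) ()
  nbr-B (A-centre _) u≡B = ⊥-elim (A≢B u≡B)
  nbr-B (A-B _)      u≡B = ⊥-elim (A≢B u≡B)
  nbr-B (B-A _)      u≡B = cong A (B-injective u≡B)

  spider-treeDepth : IsTreeDepth spider depthˢ
  spider-treeDepth = record { adjacent-levels = levels ; unique-parent = parent }
    where
    A-below-centre : ∀ i → StepDown spider depthˢ zero (A i)
    A-below-centre = depth-A

    B-below-A : ∀ i → StepDown spider depthˢ (A i) (B i)
    B-below-A i = ≡-trans (depth-B i) (cong suc (≡-sym (depth-A i)))

    levels : ∀ {u v} → Adjˢ u v → StepDown spider depthˢ u v ⊎ StepUp spider depthˢ u v
    levels (centre-A i) = inj₁ (A-below-centre i)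
    levels (A-centre i) = inj₂ (A-below-centre i)
    levels (A-B i)      = inj₁ (B-below-A i)
    levels (B-A i)      = inj₂ (B-below-A i)

    B-not-above-A : ∀ {i} → ¬ StepUp spider depthˢ (A i) (B i)
    B-not-above-A {i} up with ≡-trans (≡-sym (depth-A i)) (≡-trans up (cong suc (depth-B i)))
    ... | ()

    parent-of-A : ∀ {i w} → Adjˢ (A i) w → StepUp spider depthˢ (A i) w → w ≡ zero
    parent-of-A Aw up with nbr-A Aw refl
    ... | inj₁ w≡centre = w≡centre
    ... | inj₂ refl     = ⊥-elim (B-not-above-A up)

    parent : ∀ {u v w} → Adjˢ u v → Adjˢ u w →
             StepUp spider depthˢ u v → StepUp spider depthˢ u w → v ≡ w
    parent (A-centre i) uw _ up = ≡-sym (parent-of-A uw up)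
    parent (A-B i) _ up _ = ⊥-elim (B-not-above-A up)
    parent (B-A i) uw _ _ = ≡-sym (nbr-B uw refl)

  spider-isTree : IsTree spider
  spider-isTree = connected-via zero to-centre , treeDepth-acyclic spider depthˢ spider-treeDepth
    where
    to-centre : ∀ v → Walk spider v zero
    to-centre v with view v
    ... | centre  = here
    ... | outer i = step (A-centre i) here
    ... | leaf i  = step (B-A i) (step (A-centre i) here)

module SpiderZF (r : ℕ) where

  k : ℕ
  k = suc (suc r)

  open Spider k

  chosenA chosenB : Subset r → Subset k
  chosenA σ = outside ∷ᵛ outside ∷ᵛ σ
  chosenB σ = outside ∷ᵛ inside  ∷ᵛ ∁ σ

  -- Leg 0 is avoided, leg 1 contributes its leaf, leg j+2 contributes A or B according to σ.
  choice : Subset r → Subset (suc (k + k))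
  choice σ = outside ∷ᵛ (chosenA σ ++ᵛ chosenB σ)

  module _ {σ : Subset r} where

    A∈choice : ∀ {i} → i ∈ chosenA σ → A i ∈ choice σ
    A∈choice i∈ = there (∈-++-↑ˡ⁺ i∈)

    A∈choice⁻ : ∀ {i} → A i ∈ choice σ → i ∈ chosenA σ
    A∈choice⁻ (there i∈) = ∈-++-↑ˡ⁻ i∈

    B∈choice : ∀ {i} → i ∈ chosenB σ → B i ∈ choice σ
    B∈choice i∈ = there (∈-++-↑ʳ⁺ (chosenA σ) i∈)

    B∈choice⁻ : ∀ {i} → B i ∈ choice σ → i ∈ chosenB σ
    B∈choice⁻ (there i∈) = ∈-++-↑ʳ⁻ (chosenA σ) i∈

    chosen-exclusive : ∀ {i} → i ∈ chosenA σ → i ∈ chosenB σ → ⊥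
    chosen-exclusive (there (there j∈σ)) (there (there j∈∁σ)) = x∈∁p⇒x∉p j∈∁σ j∈σ

  module _ (σ : Subset r) where

    private
      Blueσ : V → Set
      Blueσ = Blue spider (choice σ)

    B-forces-A : ∀ {i} → Blueσ (B i) → Blueσ (A i)
    B-forces-A {i} blue-B = force-pendant spider blue-B (B-A i) (λ Bw → nbr-B Bw refl)

    B₁-blue : Blueσ (B (suc zero))
    B₁-blue = init (B∈choice (there here))

    centre-blue : Blueσ zero
    centre-blue = force (B-forces-A B₁-blue) (A-centre (suc zero)) others
      where
      others : ∀ w → Adjˢ (A (suc zero)) w → w ≢ zero → Blueσ w
      others w Aw w≢centre with nbr-A Aw refl
      ... | inj₁ w≡centre = ⊥-elim (w≢centre w≡centre)
      ... | inj₂ refl     = B₁-blue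

    A-forces-B : ∀ {i} → Blueσ (A i) → Blueσ (B i)
    A-forces-B {i} blue-A = force blue-A (A-B i) others
      where
      others : ∀ w → Adjˢ (A i) w → w ≢ B i → Blueσ w
      others w Aw w≢B with nbr-A Aw refl
      ... | inj₁ refl = centre-blue
      ... | inj₂ w≡B  = ⊥-elim (w≢B w≡B)

    outer-leg-blue : ∀ j → Blueσ (A (suc j)) × Blueσ (B (suc j))
    outer-leg-blue zero = B-forces-A B₁-blue , B₁-blue
    outer-leg-blue (suc j) with j ∈? σ
    ... | yes j∈σ = blue-A , A-forces-B blue-A
      where
      blue-A : Blueσ (A (suc (suc j)))
      blue-A = init (A∈choice (there (there j∈σ)))
    ... | no  j∉σ = B-forces-A blue-B , blue-B
      where
      blue-B : Blueσ (B (suc (suc j)))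
      blue-B = init (B∈choice (there (there (x∉p⇒x∈∁p j∉σ))))

    A₀-blue : Blueσ (A zero)
    A₀-blue = force centre-blue (centre-A zero) others
      where
      others : ∀ w → Adjˢ zero w → w ≢ A zero → Blueσ w
      others w centre-w w≢A₀ with nbr-centre centre-w
      ... | zero  , refl = ⊥-elim (w≢A₀ refl)
      ... | suc j , refl = proj₁ (outer-leg-blue j)

    choice-zeroForcing : ZeroForcing spider (choice σ)
    choice-zeroForcing v with view v
    ... | centre        = centre-blue
    ... | outer zero    = A₀-blue
    ... | outer (suc j) = proj₁ (outer-leg-blue j)
    ... | leaf zero     = A-forces-B A₀-blue
    ... | leaf (suc j)  = proj₂ (outer-leg-blue j)

  OnLeg : Fin k → V → Set
  OnLeg i v = v ≡ A i ⊎ v ≡ B i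

  OnLegs : Fin k → Fin k → V → Set
  OnLegs i j v = Σ (Fin k) λ l → (l ≡ i ⊎ l ≡ j) × OnLeg l v

  other-leg : ∀ {i j l} → i ≢ j → l ≡ i ⊎ l ≡ j → Σ (Fin k) λ l′ → (l′ ≡ i ⊎ l′ ≡ j) × l′ ≢ l
  other-leg i≢j (inj₁ refl) = _ , inj₂ refl , ≢-sym i≢j
  other-leg i≢j (inj₂ refl) = _ , inj₁ refl , i≢j

  legs-fort : ∀ {i j} → i ≢ j → IsFort spider (OnLegs i j)
  legs-fort i≢j ¬Fu (l , l∈ij , inj₂ refl) uB = ⊥-elim (¬Fu (l , l∈ij , inj₁ (nbr-B (symˢ uB) refl)))
  legs-fort i≢j ¬Fu (l , l∈ij , inj₁ refl) uA with nbr-A (symˢ uA) refl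
  ... | inj₂ u≡B = ⊥-elim (¬Fu (l , l∈ij , inj₂ u≡B))
  ... | inj₁ refl with other-leg i≢j l∈ij
  ...   | l′ , l′∈ij , l′≢l = A l′ , (l′ , l′∈ij , inj₁ refl) , centre-A l′ , l′≢l ∘ A-injective

  module _ {σ : Subset r} where

    leg₀-avoided : ∀ {v} → OnLeg zero v → v ∉ choice σ
    leg₀-avoided (inj₁ refl) A₀∈ with A∈choice⁻ A₀∈
    ... | ()
    leg₀-avoided (inj₂ refl) B₀∈ with B∈choice⁻ B₀∈
    ... | ()

    one-per-leg : ∀ {i v w} → OnLeg i v → OnLeg i w → v ∈ choice σ → w ∈ choice σ → v ≡ w
    one-per-leg (inj₁ refl) (inj₁ refl) _ _ = refl
    one-per-leg (inj₂ refl) (inj₂ refl) _ _ = refl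
    one-per-leg (inj₁ refl) (inj₂ refl) A∈ B∈ = ⊥-elim (chosen-exclusive (A∈choice⁻ A∈) (B∈choice⁻ B∈))
    one-per-leg (inj₂ refl) (inj₁ refl) B∈ A∈ = ⊥-elim (chosen-exclusive (A∈choice⁻ A∈) (B∈choice⁻ B∈))

    privateFort-onLeg : ∀ {i x} → OnLeg (suc i) x → x ∈ choice σ → PrivateFort spider (choice σ) x
    privateFort-onLeg {i} {x} on-x x∈ =
      OnLegs zero (suc i) , legs-fort (λ ()) , (suc i , inj₂ refl , on-x) , meets-only-x
      where
      meets-only-x : ∀ {w} → w ∈ choice σ → OnLegs zero (suc i) w → w ≡ x
      meets-only-x w∈ (_ , inj₁ refl , on-w) = ⊥-elim (leg₀-avoided on-w w∈)
      meets-only-x w∈ (_ , inj₂ refl , on-w) = one-per-leg on-w on-x w∈ x∈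

    privateFort : ∀ {x} → x ∈ choice σ → PrivateFort spider (choice σ) x
    privateFort {x} x∈ with view x
    ... | centre        = ⊥-elim (centre∉ x∈)
      where centre∉ : zero ∉ choice σ
            centre∉ ()
    ... | outer zero    = ⊥-elim (leg₀-avoided (inj₁ refl) x∈)
    ... | leaf zero     = ⊥-elim (leg₀-avoided (inj₂ refl) x∈)
    ... | outer (suc i) = privateFort-onLeg (inj₁ refl) x∈
    ... | leaf (suc i)  = privateFort-onLeg (inj₂ refl) x∈

  choice-minimalZF : ∀ σ → MinimalZF spider (choice σ)
  choice-minimalZF σ = privateForts⇒minimalZF spider (choice-zeroForcing σ) privateFort

  choice-injective : ∀ {σ τ} → choice σ ≡ choice τ → σ ≡ τ
  choice-injective {σ} {τ} eq =
    ∷-injectiveʳ (∷-injectiveʳ (++-injectiveˡ (chosenA σ) (chosenA τ) (∷-injectiveʳ eq)))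

  spider-atLeast : AtLeastMinZF spider (2 ^ r)
  spider-atLeast = map choice (allSubsets r) ,
                   Unique.map⁺ choice-injective (allSubsets-unique r) ,
                   All.map⁺ (All.universal choice-minimalZF (allSubsets r)) ,
                   ≤-reflexive (≡-sym (≡-trans (length-map choice (allSubsets r)) (length-allSubsets r)))

spiderOrder : ℕ → ℕ
spiderOrder r = suc (suc (suc r) + suc (suc r))

spiderOrder-suc : ∀ r → spiderOrder (suc r) ≡ 2 + spiderOrder r
spiderOrder-suc r = cong (λ n → 4 + n) (+-suc r (suc (suc r)))

-- 2r + 5 vertices and 2ʳ minimal zero forcing sets: (4/3)² ≤ 2 and 4⁵ ≤ 5·3⁵ give 4ⁿ ≤ 5·3ⁿ·2ʳ.
spider-growth : ∀ r → 4 ^ spiderOrder r ≤ 5 * 3 ^ spiderOrder r * 2 ^ r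
spider-growth zero    = ≤ᵇ⇒≤ 1024 1215 _
spider-growth (suc r) = subst (λ n → 4 ^ n ≤ 5 * 3 ^ n * 2 ^ suc r) (≡-sym (spiderOrder-suc r))
                               (two-more-vertices (spiderOrder r) (spider-growth r))
  where
  two-more-vertices : ∀ x → 4 ^ x ≤ 5 * 3 ^ x * 2 ^ r → 4 ^ (2 + x) ≤ 5 * 3 ^ (2 + x) * 2 ^ suc r
  two-more-vertices x ih = begin
    4 ^ (2 + x)                ≡⟨ ≡-sym (*-assoc 4 4 (4 ^ x)) ⟩
    16 * 4 ^ x                 ≤⟨ *-monoʳ-≤ 16 ih ⟩
    16 * (5 * 3 ^ x * 2 ^ r)   ≤⟨ *-monoˡ-≤ (5 * 3 ^ x * 2 ^ r) (≤ᵇ⇒≤ 16 18 _) ⟩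
    18 * (5 * 3 ^ x * 2 ^ r)   ≡⟨ regroup (3 ^ x) (2 ^ r) ⟩
    5 * 3 ^ (2 + x) * 2 ^ suc r ∎
    where
    open ≤-Reasoning
    regroup : ∀ a b → 18 * (5 * a * b) ≡ 5 * (3 * (3 * a)) * (2 * b)
    regroup = solve-∀

starFamily : PolyFamily
starFamily = 1 , 1 , λ m → let open StarZF m; open Star k in
  suc k , m≤n+m m 3 , star , star-isTree , star-atMost

spiderFamily : ExpFamily
spiderFamily = 4 , 3 , 5 , s≤s z≤n , ≤-refl , s≤s z≤n , λ r → let open SpiderZF r; open Spider k in
  spiderOrder r , ≤-trans (m≤m+n r (suc (suc r))) (m≤n+m _ 3) , spider , spider-isTree ,
  2 ^ r , spider-growth r , spider-atLeast

proposition2p2 : PolyFamily × ExpFamily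
proposition2p2 = starFamily , spiderFamily
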